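{- If $\Gamma$ is a context and $S,P,Q\in\mathsf{T}$ satisfy $\Gamma\vdash(S:P)$ and $\Gamma\vdash(S:Q)$, then $P\equiv_\alpha Q$.
   Context: Terms: constants $\mathsf{C}=\{\mathsf{c},\mathsf{c}',\dots\}$, variables $\mathsf{V}=\{\mathsf{v},\mathsf{v}',\dots\}$; $\mathsf{T}$ is the smallest set of strings containing $\mathsf{C}\cup\mathsf{V}$ and $\rho S$, $\beta RS$, $\lambda xRS$ for $R,S\in\mathsf{T}$, $x\in\mathsf{V}$; write $FS$ for $\beta FS$ and $\pi xPR$ for $\rho\lambda xPR$. Free variables: $\mathsf{F}(a)=\emptyset$ for constants, $\mathsf{F}(x)=\{x\}$, $\mathsf{F}(\rho R)=\mathsf{F}(R)$, $\mathsf{F}(\beta RS)=\mathsf{F}(R)\cup\mathsf{F}(S)$, $\mathsf{F}(\lambda xRS)=\mathsf{F}(R)\cup(\mathsf{F}(S)\setminus\{x\})$. Substitution: for $t\in\mathsf{C}\cup\mathsf{V}$, $t_{[T/x]}=T$ if $t=x$, else $t$; $(\rho R)_{[T/x]}=\rho R_{[T/x]}$; $(\beta RS)_{[T/x]}=\beta R_{[T/x]}S_{[T/x]}$; $(\lambda yRS)_{[T/x]}=\lambda yR_{[T/x]}S$ if $y=x$ or $x\notin\mathsf{F}(S)$, otherwise $\lambda zR_{[T/x]}S_{[z/y][T/x]}$ with $z\notin\mathsf{F}(T)\cup(\mathsf{F}(S)\setminus\{y\})$ and $z=y$ whenever $y\notin\mathsf{F}(T)$. $\alpha$-equivalence: $\mathsf{B}(T)=\{x\in\mathsf{V}\mid\lambda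 x\text{ is a substring of }T\}$, $\mathsf{V}(T)=\mathsf{F}(T)\cup\mathsf{B}(T)$; $\equiv_\alpha$ is the reflexive transitive closure of the relation replacing one subterm occurrence $\lambda xRS$ by $\lambda yRS_{[y/x]}$ with $x\notin\mathsf{B}(S)$, $y\notin\mathsf{V}(S)$ (an equivalence relation). A statement $(S:P)$ is the pair of $\equiv_\alpha$-classes of $S$ and $P$. $\mathsf{F}(\Gamma)=\bigcup_{(S:P)\in\Gamma}(\mathsf{F}(S)\cup\mathsf{F}(P))$. For a relation $\Vdash$ between sets of statements and statements, $\Gamma\Vdash\Delta$ means $\Gamma\Vdash X$ for all $X\in\Delta$; $\Vdash$ is a sequent if $X\in\Gamma$ implies $\Gamma\Vdash X$, and $\Gamma\Vdash\Delta\Vdash X$ implies $\Gamma\Vdash X$. The inference relation $\vdash$ is the smallest sequent such that for all sets $\Gamma$ of statements, $F,P,Q,R,S\in\mathsf{T}$ and $x\in\mathsf{V}\setminus(\mathsf{F}(\Gamma)\cup\mathsf{F}(Q))$: $\{(F:\pi xPR),(S:P)\}\vdash(FS:R_{[S/x]})$, and if $\Gamma\cup\{(x:Q)\}\vdash(S:P)$ then $\Gamma\vdash(\lambda xQS:\pi xQP)$. A set $\Gamma$ of statements is a context if every $(S:P)\in\Gamma$ has $S$ a constant, a variable or a term of the form $\rho R$, and whenever $(S:P),(S:Q)\in\Gamma$ we have $P\equiv_\alpha Q$. -}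

module Defs where

open import Data.Nat using (ℕ)
open import Data.Product using (_×_; _,_; Σ)
open import Data.Sum using (_⊎_)
open import Data.Empty using (⊥)
open import Data.Unit using (⊤)
open import Level using (0ℓ)
open import Relation.Nullary using (¬_)
open import Relation.Unary using (Pred; _∈_)
open import Relation.Binary.PropositionalEquality using (_≡_; _≢_)
open import Relation.Binary.Construct.Closure.ReflexiveTransitive using (Star)

Const : Set
Const = ℕ

Var : Set
Var = ℕ

data Term : Set where
  con : Const → Term
  var : Var → Term
  ρ   : Term → Term
  β   : Term → Term → Term
  lam : Var → Term → Term → Term

π : Var → Term → Term → Term
π x P R = ρ (lam x P R)

_∈F_ : Var → Term → Set
x ∈F con c = ⊥
x ∈F var y = x ≡ y
x ∈F ρ R = x ∈F R
x ∈F β R S = x ∈F R ⊎ x ∈F S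
x ∈F lam y R S = x ∈F R ⊎ (x ∈F S × x ≢ y)

_∈B_ : Var → Term → Set
x ∈B con c = ⊥
x ∈B var y = ⊥
x ∈B ρ R = x ∈B R
x ∈B β R S = x ∈B R ⊎ x ∈B S
x ∈B lam y R S = x ≡ y ⊎ (x ∈B R ⊎ x ∈B S)

_∈V_ : Var → Term → Set
x ∈V T = x ∈F T ⊎ x ∈B T

-- Sub T x S S' :  S' is (a result of) S_[T/x].
-- The definition in the paper leaves the choice of the fresh variable z open,
-- so substitution is rendered as a relation allowing every admissible choice.
data Sub (T : Term) (x : Var) : Term → Term → Set where
  sub-con  : ∀ c → Sub T x (con c) (con c)
  sub-var≡ : Sub T x (var x) T
  sub-var≢ : ∀ {y} → y ≢ x → Sub T x (var y) (var y)
  sub-ρ    : ∀ {R R'} → Sub T x R R' → Sub T x (ρ R) (ρ R')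
  sub-β    : ∀ {R R' S S'} → Sub T x R R' → Sub T x S S' →
             Sub T x (β R S) (β R' S')
  sub-lam-stop : ∀ {y R R' S} → (y ≡ x ⊎ ¬ (x ∈F S)) → Sub T x R R' →
             Sub T x (lam y R S) (lam y R' S)
  sub-lam-go : ∀ {y z R R' S S₁ S₂} → y ≢ x → x ∈F S → Sub T x R R' →
             ¬ (z ∈F T) → ¬ (z ∈F S × z ≢ y) → (¬ (y ∈F T) → z ≡ y) →
             Sub (var z) y S S₁ → Sub T x S₁ S₂ →
             Sub T x (lam y R S) (lam z R' S₂)

data αStep : Term → Term → Set where
  rename : ∀ {x y R S S'} → ¬ (x ∈B S) → ¬ (y ∈V S) → Sub (var y) x S S' →
           αStep (lam x R S) (lam y R S')
  in-ρ   : ∀ {R R'} → αStep R R' → αStep (ρ R) (ρ R')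
  in-βl  : ∀ {R R' S} → αStep R R' → αStep (β R S) (β R' S)
  in-βr  : ∀ {R S S'} → αStep S S' → αStep (β R S) (β R S')
  in-laml : ∀ {x R R' S} → αStep R R' → αStep (lam x R S) (lam x R' S)
  in-lamr : ∀ {x R S S'} → αStep S S' → αStep (lam x R S) (lam x R S')

_≡α_ : Term → Term → Set
_≡α_ = Star αStep

-- Statements (S : P), represented by a pair of representatives;
-- equality of statements is componentwise ≡α.
Stmt : Set
Stmt = Term × Term

_≈S_ : Stmt → Stmt → Set
(S , P) ≈S (S' , P') = (S ≡α S') × (P ≡α P')

SSet : Set₁
SSet = Pred Stmt 0ℓ

_∈α_ : Stmt → SSet → Set
X ∈α Γ = Σ Stmt λ Y → (Y ∈ Γ) × (Y ≈S X)

_∉FΓ_ : Var → SSet → Set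
x ∉FΓ Γ = ∀ S P → (S , P) ∈ Γ → ¬ (x ∈F S) × ¬ (x ∈F P)

_⨾_ : SSet → Stmt → SSet
(Γ ⨾ X) Y = Y ∈ Γ ⊎ Y ≡ X

pair : Stmt → Stmt → SSet
pair X Y Z = Z ≡ X ⊎ Z ≡ Y

data _⊢_ : SSet → Stmt → Set₁ where
  ax  : ∀ {Γ X} → X ∈α Γ → Γ ⊢ X
  cut : ∀ {Γ X} (Δ : SSet) → (∀ Y → Y ∈ Δ → Γ ⊢ Y) → Δ ⊢ X → Γ ⊢ X
  app : ∀ {F x P R S R'} → Sub S x R R' →
        pair (F , π x P R) (S , P) ⊢ (β F S , R')
  abs : ∀ {Γ x Q S P} → x ∉FΓ Γ → ¬ (x ∈F Q) →
        (Γ ⨾ (var x , Q)) ⊢ (S , P) → Γ ⊢ (lam x Q S , π x Q P)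

IsAtomOrρ : Term → Set
IsAtomOrρ (con c) = ⊤
IsAtomOrρ (var v) = ⊤
IsAtomOrρ (ρ R) = ⊤
IsAtomOrρ (β R S) = ⊥
IsAtomOrρ (lam x R S) = ⊥

IsContext : SSet → Set
IsContext Γ =
  (∀ S P → (S , P) ∈ Γ → IsAtomOrρ S) ×
  (∀ S P S' Q → (S , P) ∈ Γ → (S' , Q) ∈ Γ → S ≡α S' → P ≡α Q)

-- Under the locally nameless translation ⌊_⌋, α-equivalence becomes syntactic
-- equality (≡α⇒⌊⌋≡ and ⌊⌋≡⇒≡α).  A derivation of Γ ⊢ (S : P), cuts included,
-- translates into a cut-free, syntax-directed system Ax ∣ Δ ⊢ M ∶ A whose axioms
-- Ax are the translated statements of Γ, and in which the variable discharged by
-- the λ-rule becomes a generated name recorded in the local context Δ.  There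
-- every subject has at most one type, by induction on the two derivations: the
-- axioms are functional because Γ is a context, and their subjects (constants,
-- variables, ρ-terms) are the conclusion of no other rule.

module Submission where

open import Defs
open import Data.Nat using (ℕ; suc; _≟_; _<_)
open import Data.Empty using (⊥; ⊥-elim)
open import Data.List using (List; []; _∷_; _++_)
import Data.List as List
open import Data.List.Extrema.Nat using (max; xs≤max)
open import Data.List.Membership.Propositional using (_∈_; _∉_)
open import Data.List.Membership.DecPropositional _≟_ using (_∈?_)
open import Data.List.Membership.Propositional.Properties using (∈-++⁺ˡ; ∈-++⁺ʳ)
import Data.List.Relation.Unary.All as All
open import Data.List.Relation.Unary.Any using (here; there)
open import Data.Nat.Properties using (n<1+n; m<n⇒m<1+n; <-irrefl)
open import Data.Product using (_×_; _,_; Σ; proj₁; proj₂; map₁)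
open import Data.Sum using (_⊎_; inj₁; inj₂)
import Data.Sum as Sum
open import Data.Unit using (⊤; tt)
open import Function using (_∘_)
open import Relation.Binary.Construct.Closure.ReflexiveTransitive using (ε; _◅_; _◅◅_; gmap)
open import Relation.Binary.PropositionalEquality
  using (_≡_; _≢_; refl; sym; trans; cong; cong₂; subst; subst₂; module ≡-Reasoning)
open import Relation.Nullary using (¬_; Dec; yes; no)
open import Relation.Nullary.Decidable using (_⊎-dec_; _×-dec_; ¬?)

-- Besides the free variables `fvar` of the named syntax there is a second supply
-- `gvar` of names, introduced when a derivation goes under a binder; they cannot
-- clash with the variables of Γ, which may be infinite.  `bvar` are de Bruijn indices.
data LN : Set where
  lcon : Const → LN
  fvar : Var → LN
  bvar : ℕ → LN
  gvar : ℕ → LN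
  lρ   : LN → LN
  lβ   : LN → LN → LN
  lλ   : LN → LN → LN

closeAt : ℕ → Var → LN → LN
closeAt k x (fvar y) with x ≟ y
... | yes _ = bvar k
... | no _  = fvar y
closeAt k x (lρ M)   = lρ (closeAt k x M)
closeAt k x (lβ M N) = lβ (closeAt k x M) (closeAt k x N)
closeAt k x (lλ M N) = lλ (closeAt k x M) (closeAt (suc k) x N)
closeAt k x M        = M

closeGenAt : ℕ → ℕ → LN → LN
closeGenAt k g (gvar h) with g ≟ h
... | yes _ = bvar k
... | no _  = gvar h
closeGenAt k g (lρ M)   = lρ (closeGenAt k g M)
closeGenAt k g (lβ M N) = lβ (closeGenAt k g M) (closeGenAt k g N)
closeGenAt k g (lλ M N) = lλ (closeGenAt k g M) (closeGenAt (suc k) g N)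
closeGenAt k g M        = M

openAt : ℕ → LN → LN → LN
openAt k U (bvar i) with i ≟ k
... | yes _ = U
... | no _  = bvar i
openAt k U (lρ M)   = lρ (openAt k U M)
openAt k U (lβ M N) = lβ (openAt k U M) (openAt k U N)
openAt k U (lλ M N) = lλ (openAt k U M) (openAt (suc k) U N)
openAt k U M        = M

_[_≔_] : LN → Var → LN → LN
fvar y   [ x ≔ U ] with x ≟ y
... | yes _ = U
... | no _  = fvar y
lρ M     [ x ≔ U ] = lρ (M [ x ≔ U ])
lβ M N   [ x ≔ U ] = lβ (M [ x ≔ U ]) (N [ x ≔ U ])
lλ M N   [ x ≔ U ] = lλ (M [ x ≔ U ]) (N [ x ≔ U ])
M        [ x ≔ U ] = M

_∈fv_ : Var → LN → Set
x ∈fv fvar y   = x ≡ y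
x ∈fv lρ M     = x ∈fv M
x ∈fv lβ M N   = x ∈fv M ⊎ x ∈fv N
x ∈fv lλ M N   = x ∈fv M ⊎ x ∈fv N
x ∈fv _        = ⊥

gvars : LN → List ℕ
gvars (gvar g)   = g ∷ []
gvars (lρ M)     = gvars M
gvars (lβ M N)   = gvars M ++ gvars N
gvars (lλ M N)   = gvars M ++ gvars N
gvars _          = []

LC : ℕ → LN → Set
LC k (bvar i)   = i < k
LC k (lρ M)     = LC k M
LC k (lβ M N)   = LC k M × LC k N
LC k (lλ M N)   = LC k M × LC (suc k) N
LC k _          = ⊤

closeAt-≡ : ∀ k x → closeAt k x (fvar x) ≡ bvar k
closeAt-≡ k x with x ≟ x
... | yes _   = refl
... | no x≢x  = ⊥-elim (x≢x refl)

closeAt-≢ : ∀ k {x y} → x ≢ y → closeAt k x (fvar y) ≡ fvar y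
closeAt-≢ k {x} {y} x≢y with x ≟ y
... | yes x≡y = ⊥-elim (x≢y x≡y)
... | no _    = refl

[≔]-≡ : ∀ x U → fvar x [ x ≔ U ] ≡ U
[≔]-≡ x U with x ≟ x
... | yes _   = refl
... | no x≢x  = ⊥-elim (x≢x refl)

[≔]-≢ : ∀ {x y} U → x ≢ y → fvar y [ x ≔ U ] ≡ fvar y
[≔]-≢ {x} {y} U x≢y with x ≟ y
... | yes x≡y = ⊥-elim (x≢y x≡y)
... | no _    = refl

∈fv-closeAt⁻ : ∀ k y M {x} → x ∈fv closeAt k y M → x ∈fv M × x ≢ y
∈fv-closeAt⁻ k y (fvar z) x∈ with y ≟ z
... | no y≢z = x∈ , λ x≡y → y≢z (trans (sym x≡y) x∈)
∈fv-closeAt⁻ k y (lρ M)   x∈        = ∈fv-closeAt⁻ k y M x∈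
∈fv-closeAt⁻ k y (lβ M N) (inj₁ x∈) = map₁ inj₁ (∈fv-closeAt⁻ k y M x∈)
∈fv-closeAt⁻ k y (lβ M N) (inj₂ x∈) = map₁ inj₂ (∈fv-closeAt⁻ k y N x∈)
∈fv-closeAt⁻ k y (lλ M N) (inj₁ x∈) = map₁ inj₁ (∈fv-closeAt⁻ k y M x∈)
∈fv-closeAt⁻ k y (lλ M N) (inj₂ x∈) = map₁ inj₂ (∈fv-closeAt⁻ (suc k) y N x∈)

∈fv-closeAt⁺ : ∀ k y M {x} → x ∈fv M → x ≢ y → x ∈fv closeAt k y M
∈fv-closeAt⁺ k y (fvar z) x∈ x≢y with y ≟ z
... | yes y≡z = x≢y (trans x∈ (sym y≡z))
... | no _    = x∈
∈fv-closeAt⁺ k y (lρ M)   x∈        x≢y = ∈fv-closeAt⁺ k y M x∈ x≢y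
∈fv-closeAt⁺ k y (lβ M N) (inj₁ x∈) x≢y = inj₁ (∈fv-closeAt⁺ k y M x∈ x≢y)
∈fv-closeAt⁺ k y (lβ M N) (inj₂ x∈) x≢y = inj₂ (∈fv-closeAt⁺ k y N x∈ x≢y)
∈fv-closeAt⁺ k y (lλ M N) (inj₁ x∈) x≢y = inj₁ (∈fv-closeAt⁺ k y M x∈ x≢y)
∈fv-closeAt⁺ k y (lλ M N) (inj₂ x∈) x≢y = inj₂ (∈fv-closeAt⁺ (suc k) y N x∈ x≢y)

LC-closeAt : ∀ k x M → LC k M → LC (suc k) (closeAt k x M)
LC-closeAt k x (fvar y) _ with x ≟ y
... | yes _ = n<1+n k
... | no _  = tt
LC-closeAt k x (lcon c)  _       = tt
LC-closeAt k x (bvar i)  i<k     = m<n⇒m<1+n i<k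
LC-closeAt k x (gvar g)  _       = tt
LC-closeAt k x (lρ M)    lc      = LC-closeAt k x M lc
LC-closeAt k x (lβ M N)  (l , r) = LC-closeAt k x M l , LC-closeAt k x N r
LC-closeAt k x (lλ M N)  (l , r) = LC-closeAt k x M l , LC-closeAt (suc k) x N r

[≔]-fresh : ∀ U x M → ¬ x ∈fv M → M [ x ≔ U ] ≡ M
[≔]-fresh U x (fvar y) x∉ with x ≟ y
... | yes x≡y = ⊥-elim (x∉ x≡y)
... | no _    = refl
[≔]-fresh U x (lcon c)  x∉ = refl
[≔]-fresh U x (bvar i)  x∉ = refl
[≔]-fresh U x (gvar g)  x∉ = refl
[≔]-fresh U x (lρ M)    x∉ = cong lρ ([≔]-fresh U x M x∉)
[≔]-fresh U x (lβ M N)  x∉ = cong₂ lβ ([≔]-fresh U x M (x∉ ∘ inj₁)) ([≔]-fresh U x N (x∉ ∘ inj₂))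
[≔]-fresh U x (lλ M N)  x∉ = cong₂ lλ ([≔]-fresh U x M (x∉ ∘ inj₁)) ([≔]-fresh U x N (x∉ ∘ inj₂))

closeAt-fresh : ∀ k x M → ¬ x ∈fv M → closeAt k x M ≡ M
closeAt-fresh k x (fvar y) x∉ with x ≟ y
... | yes x≡y = ⊥-elim (x∉ x≡y)
... | no _    = refl
closeAt-fresh k x (lcon c)  x∉ = refl
closeAt-fresh k x (bvar i)  x∉ = refl
closeAt-fresh k x (gvar g)  x∉ = refl
closeAt-fresh k x (lρ M)    x∉ = cong lρ (closeAt-fresh k x M x∉)
closeAt-fresh k x (lβ M N)  x∉ = cong₂ lβ (closeAt-fresh k x M (x∉ ∘ inj₁)) (closeAt-fresh k x N (x∉ ∘ inj₂))
closeAt-fresh k x (lλ M N)  x∉ = cong₂ lλ (closeAt-fresh k x M (x∉ ∘ inj₁)) (closeAt-fresh (suc k) x N (x∉ ∘ inj₂))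

[≔]-id : ∀ x M → M [ x ≔ fvar x ] ≡ M
[≔]-id x (fvar y) with x ≟ y
... | yes x≡y = cong fvar x≡y
... | no _    = refl
[≔]-id x (lcon c)  = refl
[≔]-id x (bvar i)  = refl
[≔]-id x (gvar g)  = refl
[≔]-id x (lρ M)    = cong lρ ([≔]-id x M)
[≔]-id x (lβ M N)  = cong₂ lβ ([≔]-id x M) ([≔]-id x N)
[≔]-id x (lλ M N)  = cong₂ lλ ([≔]-id x M) ([≔]-id x N)

closeAt-[≔] : ∀ k z x T M → z ≢ x → ¬ z ∈fv T →
              closeAt k z (M [ x ≔ T ]) ≡ closeAt k z M [ x ≔ T ]
closeAt-[≔] k z x T (fvar y) z≢x z∉T with x ≟ y
... | yes refl = begin
  closeAt k z T                 ≡⟨ closeAt-fresh k z T z∉T ⟩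
  T                             ≡⟨ [≔]-≡ x T ⟨
  fvar x [ x ≔ T ]              ≡⟨ cong _[ x ≔ T ] (closeAt-≢ k z≢x) ⟨
  closeAt k z (fvar x) [ x ≔ T ] ∎
  where open ≡-Reasoning
... | no x≢y with z ≟ y
...   | yes _ = refl
...   | no _  = sym ([≔]-≢ T x≢y)
closeAt-[≔] k z x T (lcon c)  z≢x z∉T = refl
closeAt-[≔] k z x T (bvar i)  z≢x z∉T = refl
closeAt-[≔] k z x T (gvar g)  z≢x z∉T = refl
closeAt-[≔] k z x T (lρ M)    z≢x z∉T = cong lρ (closeAt-[≔] k z x T M z≢x z∉T)
closeAt-[≔] k z x T (lβ M N)  z≢x z∉T =
  cong₂ lβ (closeAt-[≔] k z x T M z≢x z∉T) (closeAt-[≔] k z x T N z≢x z∉T)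
closeAt-[≔] k z x T (lλ M N)  z≢x z∉T =
  cong₂ lλ (closeAt-[≔] k z x T M z≢x z∉T) (closeAt-[≔] (suc k) z x T N z≢x z∉T)

closeAt-rename : ∀ k z y M → z ≡ y ⊎ ¬ z ∈fv M → closeAt k z (M [ y ≔ fvar z ]) ≡ closeAt k y M
closeAt-rename k z .z M (inj₁ refl) = cong (closeAt k z) ([≔]-id z M)
closeAt-rename k z y M (inj₂ z∉M) = renameFresh k M z∉M
  where
  renameFresh : ∀ k M → ¬ z ∈fv M → closeAt k z (M [ y ≔ fvar z ]) ≡ closeAt k y M
  renameFresh k (fvar w) z∉ with y ≟ w
  ... | yes refl = closeAt-≡ k z
  ... | no _     = closeAt-≢ k z∉
  renameFresh k (lcon c)  z∉ = refl
  renameFresh k (bvar i)  z∉ = refl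
  renameFresh k (gvar g)  z∉ = refl
  renameFresh k (lρ M)    z∉ = cong lρ (renameFresh k M z∉)
  renameFresh k (lβ M N)  z∉ = cong₂ lβ (renameFresh k M (z∉ ∘ inj₁)) (renameFresh k N (z∉ ∘ inj₂))
  renameFresh k (lλ M N)  z∉ = cong₂ lλ (renameFresh k M (z∉ ∘ inj₁)) (renameFresh (suc k) N (z∉ ∘ inj₂))

openAt-closeAt : ∀ k U x M → LC k M → openAt k U (closeAt k x M) ≡ M [ x ≔ U ]
openAt-closeAt k U x (fvar y) _ with x ≟ y
... | no _ = refl
... | yes _ with k ≟ k
...   | yes _   = refl
...   | no k≢k  = ⊥-elim (k≢k refl)
openAt-closeAt k U x (bvar i) i<k with i ≟ k
... | yes refl = ⊥-elim (<-irrefl refl i<k)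
... | no _     = refl
openAt-closeAt k U x (lcon c)  _       = refl
openAt-closeAt k U x (gvar g)  _       = refl
openAt-closeAt k U x (lρ M)    lc      = cong lρ (openAt-closeAt k U x M lc)
openAt-closeAt k U x (lβ M N)  (l , r) = cong₂ lβ (openAt-closeAt k U x M l) (openAt-closeAt k U x N r)
openAt-closeAt k U x (lλ M N)  (l , r) = cong₂ lλ (openAt-closeAt k U x M l) (openAt-closeAt (suc k) U x N r)

closeAt-injective : ∀ k x M N → LC k M → LC k N → closeAt k x M ≡ closeAt k x N → M ≡ N
closeAt-injective k x M N lcM lcN eq = begin
  M                               ≡⟨ [≔]-id x M ⟨
  M [ x ≔ fvar x ]                ≡⟨ openAt-closeAt k (fvar x) x M lcM ⟨
  openAt k (fvar x) (closeAt k x M) ≡⟨ cong (openAt k (fvar x)) eq ⟩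
  openAt k (fvar x) (closeAt k x N) ≡⟨ openAt-closeAt k (fvar x) x N lcN ⟩
  N [ x ≔ fvar x ]                ≡⟨ [≔]-id x N ⟩
  N                               ∎
  where open ≡-Reasoning

closeGenAt-openAt : ∀ k g M → g ∉ gvars M → closeGenAt k g (openAt k (gvar g) M) ≡ M
closeGenAt-openAt k g (bvar i) _ with i ≟ k
... | no _     = refl
... | yes refl with g ≟ g
...   | yes _   = refl
...   | no g≢g  = ⊥-elim (g≢g refl)
closeGenAt-openAt k g (gvar h) g∉ with g ≟ h
... | yes refl = ⊥-elim (g∉ (here refl))
... | no _     = refl
closeGenAt-openAt k g (lcon c)  _  = refl
closeGenAt-openAt k g (fvar y)  _  = refl
closeGenAt-openAt k g (lρ M)    g∉ = cong lρ (closeGenAt-openAt k g M g∉)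
closeGenAt-openAt k g (lβ M N)  g∉ =
  cong₂ lβ (closeGenAt-openAt k g M (g∉ ∘ ∈-++⁺ˡ)) (closeGenAt-openAt k g N (g∉ ∘ ∈-++⁺ʳ (gvars M)))
closeGenAt-openAt k g (lλ M N)  g∉ =
  cong₂ lλ (closeGenAt-openAt k g M (g∉ ∘ ∈-++⁺ˡ)) (closeGenAt-openAt (suc k) g N (g∉ ∘ ∈-++⁺ʳ (gvars M)))

⌊_⌋ : Term → LN
⌊ con c ⌋     = lcon c
⌊ var x ⌋     = fvar x
⌊ ρ R ⌋       = lρ ⌊ R ⌋
⌊ β R S ⌋     = lβ ⌊ R ⌋ ⌊ S ⌋
⌊ lam x R S ⌋ = lλ ⌊ R ⌋ (closeAt 0 x ⌊ S ⌋)

⌊⌋-LC : ∀ S → LC 0 ⌊ S ⌋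
⌊⌋-LC (con c)     = tt
⌊⌋-LC (var x)     = tt
⌊⌋-LC (ρ R)       = ⌊⌋-LC R
⌊⌋-LC (β R S)     = ⌊⌋-LC R , ⌊⌋-LC S
⌊⌋-LC (lam x R S) = ⌊⌋-LC R , LC-closeAt 0 x ⌊ S ⌋ (⌊⌋-LC S)

∈fv⌊⌋⇒∈F : ∀ S {x} → x ∈fv ⌊ S ⌋ → x ∈F S
∈fv⌊⌋⇒∈F (var y)     x∈        = x∈
∈fv⌊⌋⇒∈F (ρ R)       x∈        = ∈fv⌊⌋⇒∈F R x∈
∈fv⌊⌋⇒∈F (β R S)     (inj₁ x∈) = inj₁ (∈fv⌊⌋⇒∈F R x∈)
∈fv⌊⌋⇒∈F (β R S)     (inj₂ x∈) = inj₂ (∈fv⌊⌋⇒∈F S x∈)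
∈fv⌊⌋⇒∈F (lam y R S) (inj₁ x∈) = inj₁ (∈fv⌊⌋⇒∈F R x∈)
∈fv⌊⌋⇒∈F (lam y R S) (inj₂ x∈) = inj₂ (map₁ (∈fv⌊⌋⇒∈F S) (∈fv-closeAt⁻ 0 y ⌊ S ⌋ x∈))

∈F⇒∈fv⌊⌋ : ∀ S {x} → x ∈F S → x ∈fv ⌊ S ⌋
∈F⇒∈fv⌊⌋ (var y)     x∈               = x∈
∈F⇒∈fv⌊⌋ (ρ R)       x∈               = ∈F⇒∈fv⌊⌋ R x∈
∈F⇒∈fv⌊⌋ (β R S)     (inj₁ x∈)        = inj₁ (∈F⇒∈fv⌊⌋ R x∈)
∈F⇒∈fv⌊⌋ (β R S)     (inj₂ x∈)        = inj₂ (∈F⇒∈fv⌊⌋ S x∈)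
∈F⇒∈fv⌊⌋ (lam y R S) (inj₁ x∈)        = inj₁ (∈F⇒∈fv⌊⌋ R x∈)
∈F⇒∈fv⌊⌋ (lam y R S) (inj₂ (x∈ , x≢y)) = inj₂ (∈fv-closeAt⁺ 0 y ⌊ S ⌋ (∈F⇒∈fv⌊⌋ S x∈) x≢y)

⌊⌋-Sub : ∀ {T x R R'} → Sub T x R R' → ⌊ R' ⌋ ≡ ⌊ R ⌋ [ x ≔ ⌊ T ⌋ ]
⌊⌋-Sub (sub-con c)          = refl
⌊⌋-Sub {T} {x} sub-var≡     = sym ([≔]-≡ x ⌊ T ⌋)
⌊⌋-Sub {T} (sub-var≢ y≢x)   = sym ([≔]-≢ ⌊ T ⌋ (y≢x ∘ sym))
⌊⌋-Sub (sub-ρ s)            = cong lρ (⌊⌋-Sub s)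
⌊⌋-Sub (sub-β s t)          = cong₂ lβ (⌊⌋-Sub s) (⌊⌋-Sub t)
⌊⌋-Sub {T} {x} (sub-lam-stop {y} {S = S} stop s) =
  cong₂ lλ (⌊⌋-Sub s) (sym ([≔]-fresh ⌊ T ⌋ x (closeAt 0 y ⌊ S ⌋) (x∉ stop)))
  where
  x∉ : y ≡ x ⊎ ¬ x ∈F S → ¬ x ∈fv closeAt 0 y ⌊ S ⌋
  x∉ (inj₁ refl) x∈ = proj₂ (∈fv-closeAt⁻ 0 y ⌊ S ⌋ x∈) refl
  x∉ (inj₂ x∉S)  x∈ = x∉S (∈fv⌊⌋⇒∈F S (proj₁ (∈fv-closeAt⁻ 0 y ⌊ S ⌋ x∈)))
⌊⌋-Sub {T} {x} (sub-lam-go {y} {z} {S = S} {S₁} {S₂} y≢x x∈S sR z∉T z∉S _ sS₁ sS₂) =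
  cong₂ lλ (⌊⌋-Sub sR) (begin
    closeAt 0 z ⌊ S₂ ⌋                                  ≡⟨ cong (closeAt 0 z) (⌊⌋-Sub sS₂) ⟩
    closeAt 0 z (⌊ S₁ ⌋ [ x ≔ ⌊ T ⌋ ])                  ≡⟨ cong (λ M → closeAt 0 z (M [ x ≔ ⌊ T ⌋ ])) (⌊⌋-Sub sS₁) ⟩
    closeAt 0 z (⌊ S ⌋ [ y ≔ fvar z ] [ x ≔ ⌊ T ⌋ ])    ≡⟨ closeAt-[≔] 0 z x ⌊ T ⌋ (⌊ S ⌋ [ y ≔ fvar z ]) z≢x (z∉T ∘ ∈fv⌊⌋⇒∈F T) ⟩
    closeAt 0 z (⌊ S ⌋ [ y ≔ fvar z ]) [ x ≔ ⌊ T ⌋ ]    ≡⟨ cong _[ x ≔ ⌊ T ⌋ ] (closeAt-rename 0 z y ⌊ S ⌋ z-fresh) ⟩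
    closeAt 0 y ⌊ S ⌋ [ x ≔ ⌊ T ⌋ ]                      ∎)
  where
  open ≡-Reasoning
  z≢x : z ≢ x
  z≢x refl = z∉S (x∈S , y≢x ∘ sym)
  z-fresh : z ≡ y ⊎ ¬ z ∈fv ⌊ S ⌋
  z-fresh with z ≟ y
  ... | yes z≡y = inj₁ z≡y
  ... | no z≢y  = inj₂ (λ z∈ → z∉S (∈fv⌊⌋⇒∈F S z∈ , z≢y))

⌊⌋-αStep : ∀ {A B} → αStep A B → ⌊ A ⌋ ≡ ⌊ B ⌋
⌊⌋-αStep (rename {x} {y} {R} {S} {S'} _ y∉S s) = cong (lλ ⌊ R ⌋) (sym (begin
  closeAt 0 y ⌊ S' ⌋                   ≡⟨ cong (closeAt 0 y) (⌊⌋-Sub s) ⟩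
  closeAt 0 y (⌊ S ⌋ [ x ≔ fvar y ])   ≡⟨ closeAt-rename 0 y x ⌊ S ⌋ (inj₂ (y∉S ∘ inj₁ ∘ ∈fv⌊⌋⇒∈F S)) ⟩
  closeAt 0 x ⌊ S ⌋                    ∎))
  where open ≡-Reasoning
⌊⌋-αStep (in-ρ s)    = cong lρ (⌊⌋-αStep s)
⌊⌋-αStep (in-βl s)   = cong (λ M → lβ M _) (⌊⌋-αStep s)
⌊⌋-αStep (in-βr s)   = cong (lβ _) (⌊⌋-αStep s)
⌊⌋-αStep (in-laml s) = cong (λ M → lλ M _) (⌊⌋-αStep s)
⌊⌋-αStep {lam x R S} (in-lamr s) = cong (lλ ⌊ R ⌋ ∘ closeAt 0 x) (⌊⌋-αStep s)

≡α⇒⌊⌋≡ : ∀ {A B} → A ≡α B → ⌊ A ⌋ ≡ ⌊ B ⌋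
≡α⇒⌊⌋≡ ε        = refl
≡α⇒⌊⌋≡ (s ◅ ss) = trans (⌊⌋-αStep s) (≡α⇒⌊⌋≡ ss)

_∈F?_ : ∀ x S → Dec (x ∈F S)
x ∈F? con c       = no λ ()
x ∈F? var y       = x ≟ y
x ∈F? ρ R         = x ∈F? R
x ∈F? β R S       = x ∈F? R ⊎-dec x ∈F? S
x ∈F? lam y R S   = x ∈F? R ⊎-dec (x ∈F? S ×-dec ¬? (x ≟ y))

ρ-cong : ∀ {R R'} → R ≡α R' → ρ R ≡α ρ R'
ρ-cong = gmap ρ in-ρ

β-cong : ∀ {R R' S S'} → R ≡α R' → S ≡α S' → β R S ≡α β R' S'
β-cong {R' = R'} {S = S} p q = gmap (λ R → β R S) in-βl p ◅◅ gmap (β R') in-βr q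

lam-cong : ∀ {x R R' S S'} → R ≡α R' → S ≡α S' → lam x R S ≡α lam x R' S'
lam-cong {x} {R' = R'} {S} p q = gmap (λ R → lam x R S) in-laml p ◅◅ gmap (lam x R') in-lamr q

Sub-id : ∀ u S → Sub (var u) u S S
Sub-id u (con c) = sub-con c
Sub-id u (var y) with y ≟ u
... | yes refl = sub-var≡
... | no y≢u   = sub-var≢ y≢u
Sub-id u (ρ R)   = sub-ρ (Sub-id u R)
Sub-id u (β R S) = sub-β (Sub-id u R) (Sub-id u S)
Sub-id u (lam w R S) with w ≟ u | u ∈F? S
... | yes w≡u | _       = sub-lam-stop (inj₁ w≡u) (Sub-id u R)
... | no _    | no u∉S  = sub-lam-stop (inj₂ u∉S) (Sub-id u R)
... | no w≢u  | yes u∈S =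
  sub-lam-go w≢u u∈S (Sub-id u R) w≢u (λ (_ , w≢w) → w≢w refl) (λ _ → refl) (Sub-id w S) (Sub-id u S)

Sub-rename : ∀ x y S → ¬ x ∈B S → ¬ y ∈V S →
             Σ Term λ S' → Sub (var y) x S S' × (∀ {v} → v ∈B S' → v ∈B S)
Sub-rename x y (con c) _ _ = con c , sub-con c , λ ()
Sub-rename x y (var z) _ _ with z ≟ x
... | yes refl = var y , sub-var≡ , λ ()
... | no z≢x   = var z , sub-var≢ z≢x , λ ()
Sub-rename x y (ρ R) x∉ y∉ =
  let R' , s , ⊆R = Sub-rename x y R x∉ y∉ in ρ R' , sub-ρ s , ⊆R
Sub-rename x y (β R S) x∉ y∉ =
  let R' , s , ⊆R = Sub-rename x y R (x∉ ∘ inj₁) (y∉ ∘ Sum.map inj₁ inj₁)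
      S' , t , ⊆S = Sub-rename x y S (x∉ ∘ inj₂) (y∉ ∘ Sum.map inj₂ inj₂)
  in β R' S' , sub-β s t , Sum.map ⊆R ⊆S
Sub-rename x y (lam u R S) x∉ y∉
  with Sub-rename x y R (x∉ ∘ inj₂ ∘ inj₁) (y∉ ∘ Sum.map inj₁ (inj₂ ∘ inj₁)) | x ∈F? S
... | R' , sR , ⊆R | no x∉S  = lam u R' S , sub-lam-stop (inj₂ x∉S) sR , Sum.map₂ (Sum.map₁ ⊆R)
... | R' , sR , ⊆R | yes x∈S =
  let S' , sS , ⊆S = Sub-rename x y S (x∉ ∘ inj₂ ∘ inj₂) y∉S
  in lam u R' S' ,
     sub-lam-go u≢x x∈S sR u≢y (λ (_ , u≢u) → u≢u refl) (λ _ → refl) (Sub-id u S) sS ,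
     Sum.map₂ (Sum.map ⊆R ⊆S)
  where
  u≢x : u ≢ x
  u≢x u≡x = x∉ (inj₁ (sym u≡x))
  u≢y : u ≢ y
  u≢y u≡y = y∉ (inj₂ (inj₁ (sym u≡y)))
  y∉S : ¬ y ∈V S
  y∉S (inj₂ y∈B) = y∉ (inj₂ (inj₂ (inj₂ y∈B)))
  y∉S (inj₁ y∈F) with y ≟ u
  ... | yes y≡u = y∉ (inj₂ (inj₁ y≡u))
  ... | no y≢u  = y∉ (inj₁ (inj₂ (y∈F , y≢u)))

fresh : List ℕ → ℕ
fresh L = suc (max 0 L)

fresh-∉ : ∀ L → fresh L ∉ L
fresh-∉ L ∈L = <-irrefl refl (All.lookup (xs≤max 0 L) ∈L)

vars : Term → List Var
vars (con c)     = []
vars (var x)     = x ∷ []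
vars (ρ R)       = vars R
vars (β R S)     = vars R ++ vars S
vars (lam x R S) = x ∷ vars R ++ vars S

∈V⇒∈vars : ∀ S {v} → v ∈V S → v ∈ vars S
∈V⇒∈vars (var x)     (inj₁ refl)                 = here refl
∈V⇒∈vars (ρ R)       v∈                          = ∈V⇒∈vars R v∈
∈V⇒∈vars (β R S)     (inj₁ (inj₁ v∈))            = ∈-++⁺ˡ (∈V⇒∈vars R (inj₁ v∈))
∈V⇒∈vars (β R S)     (inj₁ (inj₂ v∈))            = ∈-++⁺ʳ (vars R) (∈V⇒∈vars S (inj₁ v∈))
∈V⇒∈vars (β R S)     (inj₂ (inj₁ v∈))            = ∈-++⁺ˡ (∈V⇒∈vars R (inj₂ v∈))
∈V⇒∈vars (β R S)     (inj₂ (inj₂ v∈))            = ∈-++⁺ʳ (vars R) (∈V⇒∈vars S (inj₂ v∈))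
∈V⇒∈vars (lam x R S) (inj₁ (inj₁ v∈))            = there (∈-++⁺ˡ (∈V⇒∈vars R (inj₁ v∈)))
∈V⇒∈vars (lam x R S) (inj₁ (inj₂ (v∈ , _)))      = there (∈-++⁺ʳ (vars R) (∈V⇒∈vars S (inj₁ v∈)))
∈V⇒∈vars (lam x R S) (inj₂ (inj₁ refl))          = here refl
∈V⇒∈vars (lam x R S) (inj₂ (inj₂ (inj₁ v∈)))     = there (∈-++⁺ˡ (∈V⇒∈vars R (inj₂ v∈)))
∈V⇒∈vars (lam x R S) (inj₂ (inj₂ (inj₂ v∈)))     = there (∈-++⁺ʳ (vars R) (∈V⇒∈vars S (inj₂ v∈)))

freshen-binders : ∀ S (L : List Var) → Σ Term λ S' → S ≡α S' × (∀ {v} → v ∈ L → ¬ v ∈B S')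
freshen-binders (con c) L = con c , ε , λ _ ()
freshen-binders (var x) L = var x , ε , λ _ ()
freshen-binders (ρ R)   L = let R' , p , h = freshen-binders R L in ρ R' , ρ-cong p , h
freshen-binders (β R S) L =
  let R' , p , hR = freshen-binders R L
      S' , q , hS = freshen-binders S L
  in β R' S' , β-cong p q , λ v∈L → Sum.[ hR v∈L , hS v∈L ]
freshen-binders (lam z R S) L with freshen-binders R L | freshen-binders S (z ∷ L) | z ∈? L
... | R' , p , hR | S' , q , hS | no z∉L =
  lam z R' S' , lam-cong p q ,
  λ v∈L → Sum.[ (λ { refl → z∉L v∈L }) , Sum.[ hR v∈L , hS (there v∈L) ] ]
... | R' , p , hR | S' , q , hS | yes _ =
  let S'' , s , ⊆S' = Sub-rename z w S' (hS (here refl)) (w∉S' ∘ ∈V⇒∈vars S')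
  in lam w R' S'' , lam-cong p q ◅◅ rename (hS (here refl)) (w∉S' ∘ ∈V⇒∈vars S') s ◅ ε ,
     λ v∈L → Sum.[ (λ { refl → w∉L v∈L }) , Sum.[ hR v∈L , hS (there v∈L) ∘ ⊆S' ] ]
  where
  w = fresh (vars S' ++ L)
  w∉S' : w ∉ vars S'
  w∉S' = fresh-∉ (vars S' ++ L) ∘ ∈-++⁺ˡ
  w∉L : w ∉ L
  w∉L = fresh-∉ (vars S' ++ L) ∘ ∈-++⁺ʳ (vars S')

rename-binder : ∀ x y R S → ¬ (y ∈F S × y ≢ x) →
                Σ Term λ S' → lam x R S ≡α lam y R S' × closeAt 0 y ⌊ S' ⌋ ≡ closeAt 0 x ⌊ S ⌋
rename-binder x y R S y∉ with x ≟ y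
... | yes refl = S , ε , refl
... | no x≢y =
  let S₀ , q , h = freshen-binders S (x ∷ y ∷ [])
      ⌊S⌋≡⌊S₀⌋ = ≡α⇒⌊⌋≡ q
      y∉S₀ : ¬ y ∈fv ⌊ S₀ ⌋
      y∉S₀ y∈ = y∉ (∈fv⌊⌋⇒∈F S (subst (y ∈fv_) (sym ⌊S⌋≡⌊S₀⌋) y∈) , x≢y ∘ sym)
      y∉VS₀ : ¬ y ∈V S₀
      y∉VS₀ = Sum.[ y∉S₀ ∘ ∈F⇒∈fv⌊⌋ S₀ , h (there (here refl)) ]
      S' , s , _ = Sub-rename x y S₀ (h (here refl)) y∉VS₀
  in S' , lam-cong ε q ◅◅ rename (h (here refl)) y∉VS₀ s ◅ ε , (begin
    closeAt 0 y ⌊ S' ⌋                   ≡⟨ cong (closeAt 0 y) (⌊⌋-Sub s) ⟩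
    closeAt 0 y (⌊ S₀ ⌋ [ x ≔ fvar y ])  ≡⟨ closeAt-rename 0 y x ⌊ S₀ ⌋ (inj₂ y∉S₀) ⟩
    closeAt 0 x ⌊ S₀ ⌋                   ≡⟨ cong (closeAt 0 x) ⌊S⌋≡⌊S₀⌋ ⟨
    closeAt 0 x ⌊ S ⌋                    ∎)
  where open ≡-Reasoning

lρ-injective : ∀ {M N} → lρ M ≡ lρ N → M ≡ N
lρ-injective refl = refl

lβ-injective : ∀ {M M' N N'} → lβ M N ≡ lβ M' N' → M ≡ M' × N ≡ N'
lβ-injective refl = refl , refl

lλ-injective : ∀ {M M' N N'} → lλ M N ≡ lλ M' N' → M ≡ M' × N ≡ N'
lλ-injective refl = refl , refl

-- Structural in B: the recursive call on the body goes through the renamed S''.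
⌊⌋≡⇒≡α : ∀ A B → ⌊ A ⌋ ≡ ⌊ B ⌋ → A ≡α B
⌊⌋≡⇒≡α (con c) (con .c) refl = ε
⌊⌋≡⇒≡α (var x) (var .x) refl = ε
⌊⌋≡⇒≡α (ρ R)   (ρ R')   eq   = ρ-cong (⌊⌋≡⇒≡α R R' (lρ-injective eq))
⌊⌋≡⇒≡α (β R S) (β R' S') eq  =
  let eqR , eqS = lβ-injective eq in β-cong (⌊⌋≡⇒≡α R R' eqR) (⌊⌋≡⇒≡α S S' eqS)
⌊⌋≡⇒≡α (lam x R S) (lam y R' S') eq =
  let eqR , eqS = lλ-injective eq
      y∉ : ¬ (y ∈F S × y ≢ x)
      y∉ (y∈ , y≢x) = proj₂ (∈fv-closeAt⁻ 0 y ⌊ S' ⌋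
                        (subst (y ∈fv_) eqS (∈fv-closeAt⁺ 0 x ⌊ S ⌋ (∈F⇒∈fv⌊⌋ S y∈) y≢x))) refl
      S'' , renamed , eqS'' = rename-binder x y R S y∉
  in renamed ◅◅ lam-cong (⌊⌋≡⇒≡α R R' eqR)
       (⌊⌋≡⇒≡α S'' S' (closeAt-injective 0 y ⌊ S'' ⌋ ⌊ S' ⌋ (⌊⌋-LC S'') (⌊⌋-LC S') (trans eqS'' eqS)))

-- A cut-free type system on locally nameless terms

IsAtomOrρᴸ : LN → Set
IsAtomOrρᴸ (lcon _) = ⊤
IsAtomOrρᴸ (fvar _) = ⊤
IsAtomOrρᴸ (lρ _)   = ⊤
IsAtomOrρᴸ _        = ⊥

Axioms : Set₁
Axioms = LN → LN → Set

LCtx : Set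
LCtx = List (ℕ × LN)

dom : LCtx → List ℕ
dom = List.map proj₁

data _∋_∶_ : LCtx → ℕ → LN → Set where
  top : ∀ {Δ g A} → ((g , A) ∷ Δ) ∋ g ∶ A
  pop : ∀ {Δ g h A B} → g ≢ h → Δ ∋ g ∶ A → ((h , B) ∷ Δ) ∋ g ∶ A

∋-functional : ∀ {Δ g A A'} → Δ ∋ g ∶ A → Δ ∋ g ∶ A' → A ≡ A'
∋-functional top         top         = refl
∋-functional top         (pop g≢g _) = ⊥-elim (g≢g refl)
∋-functional (pop g≢g _) top         = ⊥-elim (g≢g refl)
∋-functional (pop _ l)   (pop _ l')  = ∋-functional l l'

∋⇒∈dom : ∀ {Δ g A} → Δ ∋ g ∶ A → g ∈ dom Δ
∋⇒∈dom top       = here refl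
∋⇒∈dom (pop _ l) = there (∋⇒∈dom l)

data _∣_⊢_∶_ (Ax : Axioms) : LCtx → LN → LN → Set where
  ⊢ax   : ∀ {Δ M A} → Ax M A → Ax ∣ Δ ⊢ M ∶ A
  ⊢gvar : ∀ {Δ g A} → Δ ∋ g ∶ A → Ax ∣ Δ ⊢ gvar g ∶ A
  ⊢β    : ∀ {Δ F T A B} → Ax ∣ Δ ⊢ F ∶ lρ (lλ A B) → Ax ∣ Δ ⊢ T ∶ A →
          Ax ∣ Δ ⊢ lβ F T ∶ openAt 0 T B
  ⊢λ    : ∀ {Δ Q M B} (L : List ℕ) →
          (∀ g → g ∉ L → Ax ∣ ((g , Q) ∷ Δ) ⊢ openAt 0 (gvar g) M ∶ openAt 0 (gvar g) B) →
          Ax ∣ Δ ⊢ lλ Q M ∶ lρ (lλ Q B)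

⊢-weaken : ∀ {Ax Δ Δ' M A} → Ax ∣ Δ ⊢ M ∶ A → (∀ {g B} → Δ ∋ g ∶ B → Δ' ∋ g ∶ B) → Ax ∣ Δ' ⊢ M ∶ A
⊢-weaken (⊢ax a)    w = ⊢ax a
⊢-weaken (⊢gvar l)  w = ⊢gvar (w l)
⊢-weaken (⊢β d e)   w = ⊢β (⊢-weaken d w) (⊢-weaken e w)
⊢-weaken (⊢λ L d)   w = ⊢λ L λ g g∉L → ⊢-weaken (d g g∉L) λ { top → top ; (pop g≢h l) → pop g≢h (w l) }

module _ {Ax : Axioms} (ax-subject : ∀ {M A} → Ax M A → IsAtomOrρᴸ M)
         (ax-functional : ∀ {M A A'} → Ax M A → Ax M A' → A ≡ A') where

  ⊢-unique : ∀ {Δ M A A'} → Ax ∣ Δ ⊢ M ∶ A → Ax ∣ Δ ⊢ M ∶ A' → A ≡ A'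
  ⊢-unique (⊢ax a)    (⊢ax a')    = ax-functional a a'
  ⊢-unique (⊢ax a)    (⊢gvar _)   = ⊥-elim (ax-subject a)
  ⊢-unique (⊢ax a)    (⊢β _ _)    = ⊥-elim (ax-subject a)
  ⊢-unique (⊢ax a)    (⊢λ _ _)    = ⊥-elim (ax-subject a)
  ⊢-unique (⊢gvar _)  (⊢ax a)     = ⊥-elim (ax-subject a)
  ⊢-unique (⊢β _ _)   (⊢ax a)     = ⊥-elim (ax-subject a)
  ⊢-unique (⊢λ _ _)   (⊢ax a)     = ⊥-elim (ax-subject a)
  ⊢-unique (⊢gvar l)  (⊢gvar l')  = ∋-functional l l'
  ⊢-unique (⊢β {T = T} d _) (⊢β d' _) =
    cong (openAt 0 T) (proj₂ (lλ-injective (lρ-injective (⊢-unique d d'))))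
  ⊢-unique (⊢λ {B = B} L d) (⊢λ {B = B'} L' d') = cong (lρ ∘ lλ _) (begin
    B                                       ≡⟨ closeGenAt-openAt 0 g B (g∉ ∘ ∈-++⁺ʳ (L ++ L') ∘ ∈-++⁺ˡ) ⟨
    closeGenAt 0 g (openAt 0 (gvar g) B)    ≡⟨ cong (closeGenAt 0 g) (⊢-unique (d g (g∉ ∘ ∈-++⁺ˡ ∘ ∈-++⁺ˡ))
                                                                              (d' g (g∉ ∘ ∈-++⁺ˡ ∘ ∈-++⁺ʳ L))) ⟩
    closeGenAt 0 g (openAt 0 (gvar g) B')   ≡⟨ closeGenAt-openAt 0 g B' (g∉ ∘ ∈-++⁺ʳ (L ++ L') ∘ ∈-++⁺ʳ (gvars B)) ⟩
    B'                                      ∎)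
    where
    open ≡-Reasoning
    avoid = (L ++ L') ++ gvars B ++ gvars B'
    g     = fresh avoid
    g∉    = fresh-∉ avoid

-- Interpretation of ⊢ in the cut-free system

Env : Set
Env = List (Var × ℕ)

envLookup : Env → Var → LN
envLookup []            y = fvar y
envLookup ((x , g) ∷ b) y with x ≟ y
... | yes _ = gvar g
... | no _  = envLookup b y

localise : Env → LN → LN
localise b (fvar y)   = envLookup b y
localise b (lρ M)     = lρ (localise b M)
localise b (lβ M N)   = lβ (localise b M) (localise b N)
localise b (lλ M N)   = lλ (localise b M) (localise b N)
localise b M          = M

localise-[] : ∀ M → localise [] M ≡ M
localise-[] (lcon c)  = refl
localise-[] (fvar y)  = refl
localise-[] (bvar i)  = refl
localise-[] (gvar g)  = refl
localise-[] (lρ M)    = cong lρ (localise-[] M)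
localise-[] (lβ M N)  = cong₂ lβ (localise-[] M) (localise-[] N)
localise-[] (lλ M N)  = cong₂ lλ (localise-[] M) (localise-[] N)

openAt-envLookup : ∀ b k U y → openAt k U (envLookup b y) ≡ envLookup b y
openAt-envLookup []            k U y = refl
openAt-envLookup ((x , g) ∷ b) k U y with x ≟ y
... | yes _ = refl
... | no _  = openAt-envLookup b k U y

localise-openAt : ∀ b k U M → localise b (openAt k U M) ≡ openAt k (localise b U) (localise b M)
localise-openAt b k U (bvar i) with i ≟ k
... | yes _ = refl
... | no _  = refl
localise-openAt b k U (fvar y)  = sym (openAt-envLookup b k (localise b U) y)
localise-openAt b k U (lcon c)  = refl
localise-openAt b k U (gvar g)  = refl
localise-openAt b k U (lρ M)    = cong lρ (localise-openAt b k U M)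
localise-openAt b k U (lβ M N)  = cong₂ lβ (localise-openAt b k U M) (localise-openAt b k U N)
localise-openAt b k U (lλ M N)  = cong₂ lλ (localise-openAt b k U M) (localise-openAt b (suc k) U N)

localise-fresh : ∀ b x g M → ¬ x ∈fv M → localise ((x , g) ∷ b) M ≡ localise b M
localise-fresh b x g (fvar y) x∉ with x ≟ y
... | yes x≡y = ⊥-elim (x∉ x≡y)
... | no _    = refl
localise-fresh b x g (lcon c)  x∉ = refl
localise-fresh b x g (bvar i)  x∉ = refl
localise-fresh b x g (gvar h)  x∉ = refl
localise-fresh b x g (lρ M)    x∉ = cong lρ (localise-fresh b x g M x∉)
localise-fresh b x g (lβ M N)  x∉ = cong₂ lβ (localise-fresh b x g M (x∉ ∘ inj₁)) (localise-fresh b x g N (x∉ ∘ inj₂))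
localise-fresh b x g (lλ M N)  x∉ = cong₂ lλ (localise-fresh b x g M (x∉ ∘ inj₁)) (localise-fresh b x g N (x∉ ∘ inj₂))

localise-[≔] : ∀ b x g M → localise b (M [ x ≔ gvar g ]) ≡ localise ((x , g) ∷ b) M
localise-[≔] b x g (fvar y) with x ≟ y
... | yes _ = refl
... | no _  = refl
localise-[≔] b x g (lcon c)  = refl
localise-[≔] b x g (bvar i)  = refl
localise-[≔] b x g (gvar h)  = refl
localise-[≔] b x g (lρ M)    = cong lρ (localise-[≔] b x g M)
localise-[≔] b x g (lβ M N)  = cong₂ lβ (localise-[≔] b x g M) (localise-[≔] b x g N)
localise-[≔] b x g (lλ M N)  = cong₂ lλ (localise-[≔] b x g M) (localise-[≔] b x g N)

openAt-localise-closeAt : ∀ b x g M → LC 0 M →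
                          openAt 0 (gvar g) (localise b (closeAt 0 x M)) ≡ localise ((x , g) ∷ b) M
openAt-localise-closeAt b x g M lc = begin
  openAt 0 (gvar g) (localise b (closeAt 0 x M))  ≡⟨ localise-openAt b 0 (gvar g) (closeAt 0 x M) ⟨
  localise b (openAt 0 (gvar g) (closeAt 0 x M))  ≡⟨ cong (localise b) (openAt-closeAt 0 (gvar g) x M lc) ⟩
  localise b (M [ x ≔ gvar g ])                   ≡⟨ localise-[≔] b x g M ⟩
  localise ((x , g) ∷ b) M                        ∎
  where open ≡-Reasoning

envLookup-≡ : ∀ b x g → envLookup ((x , g) ∷ b) x ≡ gvar g
envLookup-≡ b x g with x ≟ x
... | yes _   = refl
... | no x≢x  = ⊥-elim (x≢x refl)

⟦_⟧ : Env → Term → LN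
⟦ b ⟧ S = localise b ⌊ S ⌋

module Soundness (Ax : Axioms) where

  _⊩_∣_ : SSet → Env → LCtx → Set
  Λ ⊩ b ∣ Δ = ∀ {S P} → Λ (S , P) → Ax ∣ Δ ⊢ ⟦ b ⟧ S ∶ ⟦ b ⟧ P

  ⊢⇒⊢ᴸ : ∀ {Λ S P} → Λ ⊢ (S , P) → ∀ {b Δ} → Λ ⊩ b ∣ Δ → Ax ∣ Δ ⊢ ⟦ b ⟧ S ∶ ⟦ b ⟧ P
  ⊢⇒⊢ᴸ (ax ((_ , _) , m , S'≡αS , P'≡αP)) {b} {Δ} Λ⊩ =
    subst₂ (λ M A → Ax ∣ Δ ⊢ localise b M ∶ localise b A) (≡α⇒⌊⌋≡ S'≡αS) (≡α⇒⌊⌋≡ P'≡αP) (Λ⊩ m)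
  ⊢⇒⊢ᴸ (cut _ Δ⊢ d) Λ⊩ = ⊢⇒⊢ᴸ d λ m → ⊢⇒⊢ᴸ (Δ⊢ _ m) Λ⊩
  ⊢⇒⊢ᴸ (app {F} {x} {P} {R} {S} {R'} s) {b} {Δ} Λ⊩ =
    subst (Ax ∣ Δ ⊢ ⟦ b ⟧ (β F S) ∶_) (sym ⟦R'⟧) (⊢β (Λ⊩ (inj₁ refl)) (Λ⊩ (inj₂ refl)))
    where
    open ≡-Reasoning
    ⟦R'⟧ : ⟦ b ⟧ R' ≡ openAt 0 (⟦ b ⟧ S) (localise b (closeAt 0 x ⌊ R ⌋))
    ⟦R'⟧ = begin
      localise b ⌊ R' ⌋                                   ≡⟨ cong (localise b) (⌊⌋-Sub s) ⟩
      localise b (⌊ R ⌋ [ x ≔ ⌊ S ⌋ ])                    ≡⟨ cong (localise b) (openAt-closeAt 0 ⌊ S ⌋ x ⌊ R ⌋ (⌊⌋-LC R)) ⟨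
      localise b (openAt 0 ⌊ S ⌋ (closeAt 0 x ⌊ R ⌋))     ≡⟨ localise-openAt b 0 ⌊ S ⌋ (closeAt 0 x ⌊ R ⌋) ⟩
      openAt 0 (⟦ b ⟧ S) (localise b (closeAt 0 x ⌊ R ⌋)) ∎
  ⊢⇒⊢ᴸ {Λ} (abs {x = x} {Q} {S} {P} x∉Λ x∉Q d) {b} {Δ} Λ⊩ = ⊢λ (dom Δ) λ g g∉Δ →
    subst₂ (Ax ∣ ((g , ⟦ b ⟧ Q) ∷ Δ) ⊢_∶_)
      (sym (openAt-localise-closeAt b x g ⌊ S ⌋ (⌊⌋-LC S)))
      (sym (openAt-localise-closeAt b x g ⌊ P ⌋ (⌊⌋-LC P)))
      (⊢⇒⊢ᴸ d (extend g g∉Δ))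
    where
    extend : ∀ g → g ∉ dom Δ → (Λ ⨾ (var x , Q)) ⊩ ((x , g) ∷ b) ∣ ((g , ⟦ b ⟧ Q) ∷ Δ)
    extend g g∉Δ {S'} {P'} (inj₁ m) =
      subst₂ (Ax ∣ ((g , ⟦ b ⟧ Q) ∷ Δ) ⊢_∶_)
        (sym (localise-fresh b x g ⌊ S' ⌋ (proj₁ (x∉Λ S' P' m) ∘ ∈fv⌊⌋⇒∈F S')))
        (sym (localise-fresh b x g ⌊ P' ⌋ (proj₂ (x∉Λ S' P' m) ∘ ∈fv⌊⌋⇒∈F P')))
        (⊢-weaken (Λ⊩ m) λ l → pop (λ { refl → g∉Δ (∋⇒∈dom l) }) l)
    extend g g∉Δ (inj₂ refl) =
      subst₂ (Ax ∣ ((g , ⟦ b ⟧ Q) ∷ Δ) ⊢_∶_)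
        (sym (envLookup-≡ b x g)) (sym (localise-fresh b x g ⌊ Q ⌋ (x∉Q ∘ ∈fv⌊⌋⇒∈F Q))) (⊢gvar top)

Γᴸ : SSet → Axioms
Γᴸ Γ M A = Σ Stmt λ (S , P) → Γ (S , P) × ⌊ S ⌋ ≡ M × ⌊ P ⌋ ≡ A

Γᴸ-subject : ∀ {Γ M A} → IsContext Γ → Γᴸ Γ M A → IsAtomOrρᴸ M
Γᴸ-subject (atomic , _) ((S , P) , m , refl , refl) with S | atomic S P m
... | con _ | _ = tt
... | var _ | _ = tt
... | ρ _   | _ = tt

Γᴸ-functional : ∀ {Γ M A A'} → IsContext Γ → Γᴸ Γ M A → Γᴸ Γ M A' → A ≡ A'
Γᴸ-functional (_ , functional) ((S , P) , m , refl , refl) ((S' , P') , m' , ⌊S'⌋≡⌊S⌋ , refl) =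
  ≡α⇒⌊⌋≡ (functional S P S' P' m m' (⌊⌋≡⇒≡α S S' (sym ⌊S'⌋≡⌊S⌋)))

Γ⊢⇒Γᴸ⊢ : ∀ {Γ S P} → Γ ⊢ (S , P) → Γᴸ Γ ∣ [] ⊢ ⌊ S ⌋ ∶ ⌊ P ⌋
Γ⊢⇒Γᴸ⊢ {Γ} {S} {P} d = subst₂ (Γᴸ Γ ∣ [] ⊢_∶_) (localise-[] ⌊ S ⌋) (localise-[] ⌊ P ⌋) (⊢⇒⊢ᴸ d axioms)
  where
  open Soundness (Γᴸ Γ)
  axioms : Γ ⊩ [] ∣ []
  axioms {S'} {P'} m = subst₂ (Γᴸ Γ ∣ [] ⊢_∶_) (sym (localise-[] ⌊ S' ⌋)) (sym (localise-[] ⌊ P' ⌋))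
                         (⊢ax ((S' , P') , m , refl , refl))

proposition8p9 : (Γ : SSet) → IsContext Γ → (S P Q : Term) →
    Γ ⊢ (S , P) → Γ ⊢ (S , Q) → P ≡α Q
proposition8p9 Γ ctx S P Q ⊢P ⊢Q =
  ⌊⌋≡⇒≡α P Q (⊢-unique (Γᴸ-subject ctx) (Γᴸ-functional ctx) (Γ⊢⇒Γᴸ⊢ ⊢P) (Γ⊢⇒Γᴸ⊢ ⊢Q))
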